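{- Let $\mathcal{D}$ be a set of valued digraphs and let $H,H'$ be finite graphs such that there exists a homomorphism $\psi:H\to H'$. If the $\mathcal{D}$-signature system of $H$ has an integer solution, then the $\mathcal{D}$-signature system of $H'$ has an integer solution.
   Context: A valued digraph $(D,\phi)$ is a directed graph $D$ with an integer valuation $\phi:A(D)\to\mathbb{Z}$ of its arcs. For a graph $H$, $A(H)$ is its set of arcs (each edge $[u,v]$ gives arcs $(u,v),(v,u)$); $H$ is viewed as a symmetric digraph, and a homomorphism $f:D\to H$ maps each arc $(u,v)$ of $D$ to an arc $(f(u),f(v))$ of $H$. The subgroup $\theta(D,\phi)$ of $\mathbb{Z}^{A(H)}$ is generated by the elements $\sum_{(u,v)\in A(D)}\phi(u,v)\cdot(f(u),f(v))$ over all homomorphisms $f:D\to H$; $\theta(\mathcal{D})$ is the subgroup generated by the union of the $\theta(D,\phi)$, $(D,\phi)\in\mathcal{D}$; and $\mathcal{G}_{\mathcal{D}}(H)=\mathbb{Z}^{A(H)}/\theta(\mathcal{D})$. The $\mathcal{D}$-signature system of $H$ has an integer variable $X_{u,v}$ for each $(u,v)\in A(H)$ and an integer variable $N$, with constraints: $\sum_{v\in N_H(u)}(X_{u,v}-X_{v,u})=0$ for every vertex $u$ of $H$ (flow); $\sum_{(u,v)\in A(H)}X_{u,v}-2N=1$ (parity); and $\sum_{(u,v)\in A(H)}(X_{u,v}-X_{v,u})\cdot(u,v)\in\theta(\mathcal{D})$, i.e. equal to $0$ in $\mathcal{G}_{\mathcal{D}}(H)$ ($\mathcal{D}$-signature).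 -}

module Defs where

open import Data.Nat using (ℕ; zero; suc)
open import Data.Fin using (Fin; _≟_)
import Data.Fin as F
open import Data.Bool using (Bool; true; false; if_then_else_; _∧_)
open import Data.Integer using (ℤ; _+_; _-_; _*_) renaming (0ℤ to zeroℤ)
import Data.Integer as Z
open import Data.Product using (Σ; ∃; _×_; _,_)
open import Relation.Binary.PropositionalEquality using (_≡_)
open import Relation.Nullary.Decidable using (⌊_⌋)

sumFin : (n : ℕ) → (Fin n → ℤ) → ℤ
sumFin zero    g = zeroℤ
sumFin (suc n) g = g F.zero + sumFin n (λ i → g (F.suc i))

-- A finite (simple, undirected) graph on vertex set Fin n, given by a
-- symmetric irreflexive adjacency relation.  Its arc set A(H) is
-- { (u,v) | adj u v ≡ true }.
record Graph : Set where
  field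
    n     : ℕ
    adj   : Fin n → Fin n → Bool
    sym   : ∀ u v → adj u v ≡ adj v u
    irrefl : ∀ u → adj u u ≡ false
open Graph public

-- A finite valued digraph (D, φ): vertex set Fin m, arc set
-- { (u,v) | arc u v ≡ true }, valuation φ (only its values on arcs matter).
record ValuedDigraph : Set where
  field
    m   : ℕ
    arc : Fin m → Fin m → Bool
    φ   : Fin m → Fin m → ℤ
open ValuedDigraph public

DHom : ValuedDigraph → Graph → Set
DHom D H = Σ (Fin (m D) → Fin (n H)) λ f →
  ∀ u v → arc D u v ≡ true → adj H (f u) (f v) ≡ true

GHom : Graph → Graph → Set
GHom H H' = Σ (Fin (n H) → Fin (n H')) λ ψ →
  ∀ u v → adj H u v ≡ true → adj H' (ψ u) (ψ v) ≡ true

-- Elements of ℤ^{A(H)} represented as functions on pairs of vertices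
-- (the values at non-arcs are required to vanish where relevant).
Vect : Graph → Set
Vect H = Fin (n H) → Fin (n H) → ℤ

gen : (D : ValuedDigraph) (H : Graph) → DHom D H → Vect H
gen D H (f , _) a b =
  sumFin (m D) λ u → sumFin (m D) λ v →
    if arc D u v ∧ ⌊ f u ≟ a ⌋ ∧ ⌊ f v ≟ b ⌋ then φ D u v else zeroℤ

-- Membership in θ(𝒟): the subgroup of ℤ^{A(H)} generated by all
-- generators gen D H f with D ∈ 𝒟 (finite ℤ-linear combinations).
data θ (𝒟 : ValuedDigraph → Set) (H : Graph) : Vect H → Set where
  θ-zero : ∀ x → (∀ a b → x a b ≡ zeroℤ) → θ 𝒟 H x
  θ-step : ∀ x y (c : ℤ) (D : ValuedDigraph) → 𝒟 D → (f : DHom D H) →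
           θ 𝒟 H y → (∀ a b → x a b ≡ c * gen D H f a b + y a b) → θ 𝒟 H x

sigElem : (H : Graph) → Vect H → Vect H
sigElem H X a b = if adj H a b then X a b - X b a else zeroℤ

SignatureSolvable : (ValuedDigraph → Set) → Graph → Set
SignatureSolvable 𝒟 H = Σ (Vect H) λ X → Σ ℤ λ N →
    (∀ u → sumFin (n H) (λ v → if adj H u v then X u v - X v u else zeroℤ) ≡ zeroℤ)
  ×
    (sumFin (n H) (λ u → sumFin (n H) (λ v → if adj H u v then X u v else zeroℤ))
       - (Z.+ 2) * N ≡ Z.+ 1)
  ×
    θ 𝒟 H (sigElem H X)

-- The witness for H′ is the pushforward of the solution along ψ: the flow
-- X′(a,b) collects X(u,v) over the arcs (u,v) of H with ψ(u) = a, ψ(v) = b.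
-- Pushforward is ℤ-linear, commutes with transposition and with row sums, and
-- preserves total sums, so it carries the flow and parity constraints of H to
-- those of H′.  It is also functorial, and a generator of θ(D,φ) for f : D → H
-- is itself the pushforward of φ along f, so it is sent to the generator for
-- ψ ∘ f : D → H′; hence θ(𝒟) of H is mapped into θ(𝒟) of H′.
module Submission where

open import Defs hiding (sym)
open import Data.Nat using (zero; suc)
open import Data.Fin using (Fin; zero; suc; _≟_; punchIn)
open import Data.Fin.Properties using (punchInᵢ≢i)
open import Data.Bool using (Bool; true; false; if_then_else_; _∧_)
open import Data.Integer using (ℤ; _+_; _-_; _*_; -_; -1ℤ) renaming (0ℤ to zeroℤ)
import Data.Integer as Z
open import Data.Integer.Properties
  using (+-*-semiring; +-comm; +-identityʳ; *-zeroʳ; -1*i≡-i)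
open import Algebra.Properties.Semiring.Sum +-*-semiring
  using (sum; sum-cong-≗; sum-replicate-zero; sum-remove; ∑-distrib-+; ∑-comm;
         *-distribˡ-sum)
open import Data.Product using (_,_; proj₁; proj₂)
open import Function using (_∘_)
open import Relation.Binary.PropositionalEquality
open import Relation.Nullary.Decidable using (⌊_⌋; yes; no)

infixr 8 [_]·_
[_]·_ : Bool → ℤ → ℤ
[ c ]· x = if c then x else zeroℤ

[]·-zero : ∀ c → [ c ]· zeroℤ ≡ zeroℤ
[]·-zero true  = refl
[]·-zero false = refl

[]·-distrib-+ : ∀ c x y → [ c ]· (x + y) ≡ [ c ]· x + [ c ]· y
[]·-distrib-+ true  x y = refl
[]·-distrib-+ false x y = refl

[]·-*-comm : ∀ c k x → [ c ]· (k * x) ≡ k * [ c ]· x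
[]·-*-comm true  k x = refl
[]·-*-comm false k x = sym (*-zeroʳ k)

[]·-comm : ∀ c d x → [ c ]· [ d ]· x ≡ [ d ]· [ c ]· x
[]·-comm true  true  x = refl
[]·-comm true  false x = refl
[]·-comm false true  x = refl
[]·-comm false false x = refl

[]·-∧ : ∀ c d x → [ c ∧ d ]· x ≡ [ c ]· [ d ]· x
[]·-∧ true  d x = refl
[]·-∧ false d x = refl

⌊≟⌋-refl : ∀ {k} (i : Fin k) → ⌊ i ≟ i ⌋ ≡ true
⌊≟⌋-refl i = cong ⌊_⌋ (≡-≟-identity _≟_ refl)

⌊≟⌋-≢ : ∀ {k} {i j : Fin k} → i ≢ j → ⌊ i ≟ j ⌋ ≡ false
⌊≟⌋-≢ i≢j = cong ⌊_⌋ (≢-≟-identity _≟_ i≢j)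

sumFin≡sum : ∀ k (g : Fin k → ℤ) → sumFin k g ≡ sum g
sumFin≡sum zero    g = refl
sumFin≡sum (suc k) g = cong (g zero +_) (sumFin≡sum k (g ∘ suc))

sumFin₂≡sum₂ : ∀ k (x : Fin k → Fin k → ℤ) →
  sumFin k (λ u → sumFin k (x u)) ≡ sum (λ u → sum (x u))
sumFin₂≡sum₂ k x = trans (sumFin≡sum k _) (sum-cong-≗ (λ u → sumFin≡sum k (x u)))

sum-zero : ∀ {k} {g : Fin k → ℤ} → (∀ i → g i ≡ zeroℤ) → sum g ≡ zeroℤ
sum-zero {k} g≡0 = trans (sum-cong-≗ g≡0) (sum-replicate-zero k)

sum-[]· : ∀ {k} c (g : Fin k → ℤ) → sum (λ i → [ c ]· g i) ≡ [ c ]· sum g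
sum-[]· true      g = refl
sum-[]· {k} false g = sum-replicate-zero k

sum-δ : ∀ {k} (i : Fin k) (g : Fin k → ℤ) →
  sum (λ j → [ ⌊ i ≟ j ⌋ ]· g j) ≡ g i
sum-δ {suc k} i g = begin
  sum t                        ≡⟨ sum-remove {i = i} t ⟩
  t i + sum (t ∘ punchIn i)    ≡⟨ cong₂ _+_ t-at-i t-elsewhere ⟩
  g i + zeroℤ                  ≡⟨ +-identityʳ (g i) ⟩
  g i                          ∎
  where
  open ≡-Reasoning
  t : Fin (suc k) → ℤ
  t j = [ ⌊ i ≟ j ⌋ ]· g j
  t-at-i : t i ≡ g i
  t-at-i = cong (λ c → [ c ]· g i) (⌊≟⌋-refl i)
  t-elsewhere : sum (t ∘ punchIn i) ≡ zeroℤ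
  t-elsewhere = sum-zero λ j →
    cong (λ c → [ c ]· g (punchIn i j)) (⌊≟⌋-≢ (punchInᵢ≢i i j ∘ sym))

push : ∀ {k l} → (Fin k → Fin l) → (Fin k → ℤ) → Fin l → ℤ
push ψ g a = sum λ u → [ ⌊ ψ u ≟ a ⌋ ]· g u

push-cong : ∀ {k l} (ψ : Fin k → Fin l) {g h : Fin k → ℤ} →
  (∀ u → g u ≡ h u) → ∀ a → push ψ g a ≡ push ψ h a
push-cong ψ g≡h a = sum-cong-≗ (λ u → cong ([ ⌊ ψ u ≟ a ⌋ ]·_) (g≡h u))

push-linear : ∀ {k l} (ψ : Fin k → Fin l) c (g h : Fin k → ℤ) a →
  push ψ (λ u → c * g u + h u) a ≡ c * push ψ g a + push ψ h a
push-linear ψ c g h a = begin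
  push ψ (λ u → c * g u + h u) a     ≡⟨ sum-cong-≗ distrib ⟩
  sum (λ u → c * g′ u + h′ u)        ≡⟨ ∑-distrib-+ (λ u → c * g′ u) h′ ⟩
  sum (λ u → c * g′ u) + sum h′      ≡⟨ cong (_+ sum h′) (*-distribˡ-sum c g′) ⟨
  c * push ψ g a + push ψ h a        ∎
  where
  open ≡-Reasoning
  g′ h′ : Fin _ → ℤ
  g′ u = [ ⌊ ψ u ≟ a ⌋ ]· g u
  h′ u = [ ⌊ ψ u ≟ a ⌋ ]· h u
  distrib : ∀ u → [ ⌊ ψ u ≟ a ⌋ ]· (c * g u + h u) ≡ c * g′ u + h′ u
  distrib u = trans ([]·-distrib-+ ⌊ ψ u ≟ a ⌋ (c * g u) (h u))
                    (cong (_+ h′ u) ([]·-*-comm ⌊ ψ u ≟ a ⌋ c (g u)))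

push-sub : ∀ {k l} (ψ : Fin k → Fin l) (g h : Fin k → ℤ) a →
  push ψ (λ u → g u - h u) a ≡ push ψ g a - push ψ h a
push-sub ψ g h a = begin
  push ψ (λ u → g u - h u) a          ≡⟨ push-cong ψ (λ u → sub-as-linear (g u) (h u)) a ⟩
  push ψ (λ u → -1ℤ * h u + g u) a    ≡⟨ push-linear ψ -1ℤ h g a ⟩
  -1ℤ * push ψ h a + push ψ g a       ≡⟨ sub-as-linear (push ψ g a) (push ψ h a) ⟨
  push ψ g a - push ψ h a             ∎
  where
  open ≡-Reasoning
  sub-as-linear : ∀ x y → x - y ≡ -1ℤ * y + x
  sub-as-linear x y = trans (+-comm x (- y)) (cong (_+ x) (sym (-1*i≡-i y)))

push-[]· : ∀ {k l} (ψ : Fin k → Fin l) c (g : Fin k → ℤ) a →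
  push ψ (λ u → [ c ]· g u) a ≡ [ c ]· push ψ g a
push-[]· ψ c g a = trans (sum-cong-≗ (λ u → []·-comm ⌊ ψ u ≟ a ⌋ c (g u)))
                         (sum-[]· c (λ u → [ ⌊ ψ u ≟ a ⌋ ]· g u))

push-sum : ∀ {k l r} (ψ : Fin k → Fin l) (h : Fin k → Fin r → ℤ) a →
  sum (λ j → push ψ (λ u → h u j) a) ≡ push ψ (λ u → sum (h u)) a
push-sum ψ h a = trans (∑-comm (λ j u → [ ⌊ ψ u ≟ a ⌋ ]· h u j))
                       (sum-cong-≗ (λ u → sum-[]· _ (h u)))

push-total : ∀ {k l} (ψ : Fin k → Fin l) (g : Fin k → ℤ) → sum (push ψ g) ≡ sum g
push-total ψ g = trans (∑-comm (λ a u → [ ⌊ ψ u ≟ a ⌋ ]· g u))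
                       (sum-cong-≗ (λ u → sum-δ (ψ u) (λ _ → g u)))

push-δ : ∀ {k l} (ψ : Fin k → Fin l) (i : Fin k) x a →
  push ψ (λ u → [ ⌊ i ≟ u ⌋ ]· x) a ≡ [ ⌊ ψ i ≟ a ⌋ ]· x
push-δ ψ i x a = trans (sum-cong-≗ (λ u → []·-comm ⌊ ψ u ≟ a ⌋ ⌊ i ≟ u ⌋ x))
                       (sum-δ i (λ u → [ ⌊ ψ u ≟ a ⌋ ]· x))

push-∘ : ∀ {k l r} (ψ : Fin l → Fin r) (f : Fin k → Fin l) (g : Fin k → ℤ) a →
  push ψ (push f g) a ≡ push (ψ ∘ f) g a
push-∘ ψ f g a = trans (sym (push-sum ψ (λ u p → [ ⌊ f p ≟ u ⌋ ]· g p) a))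
                       (sum-cong-≗ (λ p → push-δ ψ (f p) (g p) a))

push-comm : ∀ {k k′ l l′} (ψ : Fin k → Fin l) (φ : Fin k′ → Fin l′)
  (x : Fin k′ → Fin k → ℤ) u b →
  push ψ (λ v → push φ (λ p → x p v) u) b ≡ push φ (λ p → push ψ (x p) b) u
push-comm ψ φ x u b = trans (sum-cong-≗ (λ v → sym (push-[]· φ _ (λ p → x p v) u)))
                            (push-sum φ (λ p v → [ ⌊ ψ v ≟ b ⌋ ]· x p v) u)

push₂ : ∀ {k l} → (Fin k → Fin l) → (Fin k → Fin k → ℤ) → Fin l → Fin l → ℤ
push₂ ψ x a b = push ψ (λ u → push ψ (x u) b) a

push₂-cong : ∀ {k l} (ψ : Fin k → Fin l) {x y : Fin k → Fin k → ℤ} →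
  (∀ u v → x u v ≡ y u v) → ∀ a b → push₂ ψ x a b ≡ push₂ ψ y a b
push₂-cong ψ x≡y a b = push-cong ψ (λ u → push-cong ψ (x≡y u) b) a

push₂-linear : ∀ {k l} (ψ : Fin k → Fin l) c (x y : Fin k → Fin k → ℤ) a b →
  push₂ ψ (λ u v → c * x u v + y u v) a b ≡ c * push₂ ψ x a b + push₂ ψ y a b
push₂-linear ψ c x y a b =
  trans (push-cong ψ (λ u → push-linear ψ c (x u) (y u) b) a) (push-linear ψ c _ _ a)

push₂-sub : ∀ {k l} (ψ : Fin k → Fin l) (x y : Fin k → Fin k → ℤ) a b →
  push₂ ψ (λ u v → x u v - y u v) a b ≡ push₂ ψ x a b - push₂ ψ y a b
push₂-sub ψ x y a b =
  trans (push-cong ψ (λ u → push-sub ψ (x u) (y u) b) a) (push-sub ψ _ _ a)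

push₂-transpose : ∀ {k l} (ψ : Fin k → Fin l) (x : Fin k → Fin k → ℤ) a b →
  push₂ ψ x b a ≡ push₂ ψ (λ u v → x v u) a b
push₂-transpose ψ x a b = sym (push-comm ψ ψ x b a)

push₂-∘ : ∀ {k l r} (ψ : Fin l → Fin r) (f : Fin k → Fin l)
  (w : Fin k → Fin k → ℤ) a b →
  push₂ ψ (push₂ f w) a b ≡ push₂ (ψ ∘ f) w a b
push₂-∘ ψ f w a b = begin
  push ψ (λ u → push ψ (λ v → push f (λ p → push f (w p) v) u) b) a
    ≡⟨ push-cong ψ (λ u → push-comm ψ f (λ p → push f (w p)) u b) a ⟩
  push ψ (push f (λ p → push ψ (push f (w p)) b)) a
    ≡⟨ push-∘ ψ f _ a ⟩
  push (ψ ∘ f) (λ p → push ψ (push f (w p)) b) a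
    ≡⟨ push-cong (ψ ∘ f) (λ p → push-∘ ψ f (w p) b) a ⟩
  push₂ (ψ ∘ f) w a b
    ∎
  where open ≡-Reasoning

push₂-rowSum : ∀ {k l} (ψ : Fin k → Fin l) (x : Fin k → Fin k → ℤ) a →
  sum (push₂ ψ x a) ≡ push ψ (λ u → sum (x u)) a
push₂-rowSum ψ x a = trans (push-sum ψ (λ u b → push ψ (x u) b) a)
                           (push-cong ψ (λ u → push-total ψ (x u)) a)

push₂-total : ∀ {k l} (ψ : Fin k → Fin l) (x : Fin k → Fin k → ℤ) →
  sum (λ a → sum (push₂ ψ x a)) ≡ sum (λ u → sum (x u))
push₂-total ψ x = trans (sum-cong-≗ (push₂-rowSum ψ x)) (push-total ψ _)

push₂-vanishes : ∀ {k l} (ψ : Fin k → Fin l) (x : Fin k → Fin k → ℤ) a b →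
  (∀ u v → ψ u ≡ a → ψ v ≡ b → x u v ≡ zeroℤ) → push₂ ψ x a b ≡ zeroℤ
push₂-vanishes ψ x a b x≡0 = sum-zero row
  where
  entry : ∀ u → ψ u ≡ a → ∀ v → [ ⌊ ψ v ≟ b ⌋ ]· x u v ≡ zeroℤ
  entry u ψu≡a v with ψ v ≟ b
  ... | no  _     = refl
  ... | yes ψv≡b = x≡0 u v ψu≡a ψv≡b
  row : ∀ u → [ ⌊ ψ u ≟ a ⌋ ]· push ψ (x u) b ≡ zeroℤ
  row u with ψ u ≟ a
  ... | no  _     = refl
  ... | yes ψu≡a = sum-zero (entry u ψu≡a)

valuation : (D : ValuedDigraph) → Fin (m D) → Fin (m D) → ℤ
valuation D p q = [ arc D p q ]· φ D p q

gen≡push₂ : ∀ D H (f : DHom D H) a b →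
  gen D H f a b ≡ push₂ (proj₁ f) (valuation D) a b
gen≡push₂ D H (f , f-hom) a b = begin
  gen D H (f , f-hom) a b
    ≡⟨ sumFin₂≡sum₂ (m D) (λ p q → [ selected p q ]· φ D p q) ⟩
  sum (λ p → sum (λ q → [ selected p q ]· φ D p q))
    ≡⟨ sum-cong-≗ (λ p → trans (sum-cong-≗ (reorder p))
                               (sum-[]· ⌊ f p ≟ a ⌋ (λ q → [ ⌊ f q ≟ b ⌋ ]· valuation D p q))) ⟩
  push₂ f (valuation D) a b
    ∎
  where
  open ≡-Reasoning
  selected : Fin (m D) → Fin (m D) → Bool
  selected p q = arc D p q ∧ ⌊ f p ≟ a ⌋ ∧ ⌊ f q ≟ b ⌋
  []·-∧-rotate : ∀ c d e x → [ c ∧ d ∧ e ]· x ≡ [ d ]· [ e ]· [ c ]· x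
  []·-∧-rotate true  d e x = []·-∧ d e x
  []·-∧-rotate false d e x = sym (trans (cong ([ d ]·_) ([]·-zero e)) ([]·-zero d))
  reorder : ∀ p q →
    [ selected p q ]· φ D p q ≡ [ ⌊ f p ≟ a ⌋ ]· [ ⌊ f q ≟ b ⌋ ]· valuation D p q
  reorder p q = []·-∧-rotate (arc D p q) ⌊ f p ≟ a ⌋ ⌊ f q ≟ b ⌋ (φ D p q)

θ-cong : ∀ {𝒟 H} {x y : Vect H} → θ 𝒟 H x → (∀ a b → x a b ≡ y a b) → θ 𝒟 H y
θ-cong (θ-zero x x≡0) x≡y = θ-zero _ (λ a b → trans (sym (x≡y a b)) (x≡0 a b))
θ-cong (θ-step x y c D D∈𝒟 f t x≡) x≡y =
  θ-step _ y c D D∈𝒟 f t (λ a b → trans (sym (x≡y a b)) (x≡ a b))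

Supported : (H : Graph) → Vect H → Set
Supported H x = ∀ u v → adj H u v ≡ false → x u v ≡ zeroℤ

-- Entries of X at non-arcs are unconstrained junk; they must be discarded
-- before pushing forward, as ψ may send a non-arc of H onto an arc of H′.
restrict : (H : Graph) → Vect H → Vect H
restrict H X u v = [ adj H u v ]· X u v

restrict-supported : ∀ H X → Supported H (restrict H X)
restrict-supported H X u v uv≡false = cong (λ c → [ c ]· X u v) uv≡false

[]·-supported : ∀ H {x} → Supported H x → ∀ a b → [ adj H a b ]· x a b ≡ x a b
[]·-supported H supp a b with adj H a b in ab
... | true  = refl
... | false = sym (supp a b ab)

sigElem-supported : ∀ H {x} → Supported H x → ∀ a b →
  sigElem H x a b ≡ x a b - x b a
sigElem-supported H {x} supp a b with adj H a b in ab
... | true  = refl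
... | false = sym (cong₂ _-_ (supp a b ab) (supp b a (trans (Graph.sym H b a) ab)))

restrict-antisym : ∀ H X u v → restrict H X u v - restrict H X v u ≡ sigElem H X u v
restrict-antisym H X u v rewrite Graph.sym H v u with adj H u v
... | true  = refl
... | false = refl

Balanced : (H : Graph) → Vect H → Set
Balanced H X = ∀ u → sumFin (n H) (sigElem H X u) ≡ zeroℤ

module Pushforward (H H′ : Graph) (hom : GHom H H′) where

  ψ : Fin (n H) → Fin (n H′)
  ψ = proj₁ hom

  compose : ∀ D → DHom D H → DHom D H′
  compose D (f , f-hom) = ψ ∘ f , λ u v uv → proj₂ hom (f u) (f v) (f-hom u v uv)

  push₂-gen : ∀ D (f : DHom D H) a b →
    push₂ ψ (gen D H f) a b ≡ gen D H′ (compose D f) a b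
  push₂-gen D f a b = begin
    push₂ ψ (gen D H f) a b                      ≡⟨ push₂-cong ψ (gen≡push₂ D H f) a b ⟩
    push₂ ψ (push₂ (proj₁ f) (valuation D)) a b  ≡⟨ push₂-∘ ψ (proj₁ f) (valuation D) a b ⟩
    push₂ (ψ ∘ proj₁ f) (valuation D) a b        ≡⟨ gen≡push₂ D H′ (compose D f) a b ⟨
    gen D H′ (compose D f) a b                   ∎
    where open ≡-Reasoning

  θ-push₂ : ∀ {𝒟 x} → θ 𝒟 H x → θ 𝒟 H′ (push₂ ψ x)
  θ-push₂ (θ-zero x x≡0) =
    θ-zero _ (λ a b → push₂-vanishes ψ x a b (λ u v _ _ → x≡0 u v))
  θ-push₂ (θ-step x y c D D∈𝒟 f t x≡) =
    θ-step _ _ c D D∈𝒟 (compose D f) (θ-push₂ t) λ a b → begin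
      push₂ ψ x a b
        ≡⟨ push₂-cong ψ x≡ a b ⟩
      push₂ ψ (λ u v → c * gen D H f u v + y u v) a b
        ≡⟨ push₂-linear ψ c (gen D H f) y a b ⟩
      c * push₂ ψ (gen D H f) a b + push₂ ψ y a b
        ≡⟨ cong (λ z → c * z + push₂ ψ y a b) (push₂-gen D f a b) ⟩
      c * gen D H′ (compose D f) a b + push₂ ψ y a b
        ∎
    where open ≡-Reasoning

  push₂-supported : ∀ {x} → Supported H x → Supported H′ (push₂ ψ x)
  push₂-supported {x} supp a b ab≡false = push₂-vanishes ψ x a b entry
    where
    entry : ∀ u v → ψ u ≡ a → ψ v ≡ b → x u v ≡ zeroℤ
    entry u v ψu≡a ψv≡b with adj H u v in uv
    ... | false = supp u v uv
    ... | true with () ← trans (sym (proj₂ hom u v uv))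
                               (trans (cong₂ (adj H′) ψu≡a ψv≡b) ab≡false)

  module _ (X : Vect H) where

    X′ : Vect H′
    X′ = push₂ ψ (restrict H X)

    X′-supported : Supported H′ X′
    X′-supported = push₂-supported (restrict-supported H X)

    sigElem-push₂ : ∀ a b → sigElem H′ X′ a b ≡ push₂ ψ (sigElem H X) a b
    sigElem-push₂ a b = begin
      sigElem H′ X′ a b
        ≡⟨ sigElem-supported H′ X′-supported a b ⟩
      X′ a b - X′ b a
        ≡⟨ cong (λ z → X′ a b - z) (push₂-transpose ψ Y a b) ⟩
      X′ a b - push₂ ψ (λ u v → Y v u) a b
        ≡⟨ push₂-sub ψ Y (λ u v → Y v u) a b ⟨
      push₂ ψ (λ u v → Y u v - Y v u) a b
        ≡⟨ push₂-cong ψ (restrict-antisym H X) a b ⟩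
      push₂ ψ (sigElem H X) a b
        ∎
      where
      open ≡-Reasoning
      Y : Vect H
      Y = restrict H X

    balanced-push₂ : Balanced H X → Balanced H′ X′
    balanced-push₂ balanced a = begin
      sumFin (n H′) (sigElem H′ X′ a)           ≡⟨ sumFin≡sum (n H′) _ ⟩
      sum (sigElem H′ X′ a)                     ≡⟨ sum-cong-≗ (sigElem-push₂ a) ⟩
      sum (push₂ ψ (sigElem H X) a)             ≡⟨ push₂-rowSum ψ (sigElem H X) a ⟩
      push ψ (λ u → sum (sigElem H X u)) a      ≡⟨ push-cong ψ rowSum≡0 a ⟩
      push ψ (λ _ → zeroℤ) a                    ≡⟨ sum-zero (λ u → []·-zero ⌊ ψ u ≟ a ⌋) ⟩
      zeroℤ                                     ∎
      where
      open ≡-Reasoning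
      rowSum≡0 : ∀ u → sum (sigElem H X u) ≡ zeroℤ
      rowSum≡0 u = trans (sym (sumFin≡sum (n H) (sigElem H X u))) (balanced u)

    arcSum-push₂ : sumFin (n H′) (λ a → sumFin (n H′) (restrict H′ X′ a))
                 ≡ sumFin (n H) (λ u → sumFin (n H) (restrict H X u))
    arcSum-push₂ = begin
      sumFin (n H′) (λ a → sumFin (n H′) (restrict H′ X′ a))
        ≡⟨ sumFin₂≡sum₂ (n H′) (restrict H′ X′) ⟩
      sum (λ a → sum (restrict H′ X′ a))
        ≡⟨ sum-cong-≗ (λ a → sum-cong-≗ ([]·-supported H′ X′-supported a)) ⟩
      sum (λ a → sum (X′ a))
        ≡⟨ push₂-total ψ (restrict H X) ⟩
      sum (λ u → sum (restrict H X u))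
        ≡⟨ sumFin₂≡sum₂ (n H) (restrict H X) ⟨
      sumFin (n H) (λ u → sumFin (n H) (restrict H X u))
        ∎
      where open ≡-Reasoning

proposition11 : (𝒟 : ValuedDigraph → Set) (H H' : Graph) →
    GHom H H' → SignatureSolvable 𝒟 H → SignatureSolvable 𝒟 H'
proposition11 𝒟 H H' hom (X , N , balanced , parity , signature) =
  X′ X , N , balanced-push₂ X balanced ,
  trans (cong (_- Z.+ 2 * N) (arcSum-push₂ X)) parity ,
  θ-cong (θ-push₂ signature) (λ a b → sym (sigElem-push₂ X a b))
  where open Pushforward H H' hom
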